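{- Let $t\ge1$ and $k\ge1$ be integers. Then \[\gamma_{[k]R}(C_{4t}\square P_2)=(k+1)\gamma(C_{4t}\square P_2)=2(k+1)t.\]
   Context: $C_m$ is the cycle on $m$ vertices, $P_n$ the path on $n$ vertices, $\square$ the Cartesian product, and $\gamma$ the domination number. For an integer $k\ge1$ and a labeling $f:V(G)\to\{0,1,\dots,k+1\}$, let $AN(v)=\{u\in N(v): f(u)>0\}$. The labeling $f$ is a $[k]$-Roman dominating function if every vertex $v$ with $f(v)<k$ satisfies $f(N[v])\ge k+|AN(v)|$, where $N[v]=N(v)\cup\{v\}$ and $f(X)=\sum_{x\in X}f(x)$. $\gamma_{[k]R}(G)$ is the minimum of $\sum_v f(v)$ over all $[k]$-Roman dominating functions $f$ on $G$. -}

module Defs where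

open import Data.Nat using (ℕ; zero; suc; _+_; _*_; _≤_; _<_; _≡ᵇ_)
open import Data.Bool using (Bool; true; false; _∧_; _∨_; if_then_else_)
open import Data.Fin using (Fin; toℕ; remQuot)
open import Data.Fin.Properties using (_≟_)
open import Data.List using (List; map; filter; length; allFin)
open import Data.Nat.ListAction using (sum)
open import Data.Sum using (_⊎_)
open import Data.Product using (_×_; _,_; Σ; ∃)
open import Relation.Nullary.Decidable using (⌊_⌋)
open import Relation.Binary.PropositionalEquality using (_≡_)

-- A finite simple graph on vertex set Fin n, with Boolean adjacency
-- (symmetric and irreflexive for all graphs constructed below).
record Graph : Set where
  field
    size : ℕ
    adj  : Fin size → Fin size → Bool
open Graph public

cycle : ℕ → Graph
cycle m = record { size = m ; adj = λ i j →
  (toℕ j ≡ᵇ suc (toℕ i)) ∨ (toℕ i ≡ᵇ suc (toℕ j))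
  ∨ ((toℕ i ≡ᵇ 0) ∧ (suc (toℕ j) ≡ᵇ m))
  ∨ ((toℕ j ≡ᵇ 0) ∧ (suc (toℕ i) ≡ᵇ m)) }

path : ℕ → Graph
path n = record { size = n ; adj = λ i j →
  (toℕ j ≡ᵇ suc (toℕ i)) ∨ (toℕ i ≡ᵇ suc (toℕ j)) }

_□_ : Graph → Graph → Graph
G □ H = record { size = size G * size H ; adj = λ x y → go (remQuot (size H) x) (remQuot (size H) y) }
  where
  go : Fin (size G) × Fin (size H) → Fin (size G) × Fin (size H) → Bool
  go (a , b) (c , d) = (⌊ a ≟ c ⌋ ∧ adj H b d) ∨ (adj G a c ∧ ⌊ b ≟ d ⌋)

nbrs : (G : Graph) → Fin (size G) → List (Fin (size G))
nbrs G v = filter (λ u → adj G v u Data.Bool.≟ true) (allFin (size G))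

weight : (G : Graph) → (Fin (size G) → ℕ) → ℕ
weight G f = sum (map f (allFin (size G)))

closedNbrSum : (G : Graph) → (Fin (size G) → ℕ) → Fin (size G) → ℕ
closedNbrSum G f v = f v + sum (map f (nbrs G v))

activeNbrs : (G : Graph) → (Fin (size G) → ℕ) → Fin (size G) → ℕ
activeNbrs G f v = length (filter (λ u → 1 Data.Nat.≤? f u) (nbrs G v))

IsKRDF : ℕ → (G : Graph) → (Fin (size G) → ℕ) → Set
IsKRDF k G f =
  ((v : Fin (size G)) → f v ≤ suc k) ×
  ((v : Fin (size G)) → f v < k → k + activeNbrs G f v ≤ closedNbrSum G f v)

IsDominatingSet : (G : Graph) → (Fin (size G) → Bool) → Set
IsDominatingSet G D = (v : Fin (size G)) →
  (D v ≡ true) ⊎ (Σ (Fin (size G)) λ u → (adj G v u ≡ true) × (D u ≡ true))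

setSize : (G : Graph) → (Fin (size G) → Bool) → ℕ
setSize G D = weight G (λ v → if D v then 1 else 0)

IsMinimum : {A : Set} → (A → Set) → (A → ℕ) → ℕ → Set
IsMinimum {A} P w m = (Σ A λ x → P x × (w x ≡ m)) × ((x : A) → P x → m ≤ w x)

DominationNumberIs : Graph → ℕ → Set
DominationNumberIs G m = IsMinimum (IsDominatingSet G) (setSize G) m

KRomanDominationNumberIs : ℕ → Graph → ℕ → Set
KRomanDominationNumberIs k G m = IsMinimum (IsKRDF k G) (weight G) m

module Submission where

-- The prism C_m □ P_2 is a symmetric cubic graph, so every vertex lies in exactly four closed
-- neighbourhoods and Σ_v g(N[v]) = 4 Σ_v g(v) for every labeling g.  This double counting gives
-- γ ≥ |V|/4 = 2t at once.  For a [k]-Roman dominating function f every vertex has f(N[v]) ≥ k + 1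
-- except the deficient ones (f(v) = k and f = 0 on N(v)).  A neighbour u of a deficient vertex has
-- f(u) = 0 and needs a second active neighbour, so f(N[u]) - (k + 1) ≥ |AN(u)| - 1 leaves a share
-- of 1/3 for each deficient neighbour; hence still Σ_v f(N[v]) ≥ (k + 1)|V|, i.e. w(f) ≥ 2t(k + 1).
-- For m = 4t the vertices (4j, 0) and (4j + 2, 1) form a perfect code, meeting every closed
-- neighbourhood exactly once: it is a dominating set of size 2t, and putting k + 1 on it gives a
-- [k]-RDF of weight 2t(k + 1).

open import Defs
open import Data.Bool using (Bool; true; false; T; if_then_else_; _∧_; _∨_)
import Data.Bool as Bool
open import Data.Bool.Properties using (∨-comm; ∨-assoc; T-∨; T-∧; T-≡)
open import Data.Empty using (⊥; ⊥-elim)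
open import Data.Fin using (Fin; zero; suc; toℕ; fromℕ<; combine; remQuot; opposite)
open import Data.Fin.Patterns using (0F; 1F)
open import Data.Fin.Properties
  using (toℕ-fromℕ<; toℕ-injective; toℕ<n; remQuot-combine; combine-remQuot; combine-injective)
import Data.Fin.Properties as Fin
open import Data.List using (List; []; _∷_; map; filter; length; allFin; tabulate)
open import Data.List.Properties using (map-tabulate; map-cong; map-cong-local)
open import Data.List.Membership.Propositional using (_∈_)
open import Data.List.Membership.Propositional.Properties using (∈-filter⁺; ∈-filter⁻; ∈-allFin)
open import Data.List.Membership.Propositional.Properties.WithK using (unique∧set⇒bag)
open import Data.List.Relation.Binary.BagAndSetEquality using (∼bag⇒↭)
open import Data.List.Relation.Binary.Permutation.Propositional using (_↭_)
open import Data.List.Relation.Binary.Permutation.Propositional.Properties using (↭-length; map⁺)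
open import Data.List.Relation.Unary.All using (All; []; _∷_)
import Data.List.Relation.Unary.All as All
open import Data.List.Relation.Unary.AllPairs using ([]; _∷_)
open import Data.List.Relation.Unary.Any using (here; there)
open import Data.List.Relation.Unary.Unique.Propositional using (Unique)
open import Data.List.Relation.Unary.Unique.Propositional.Properties using (allFin⁺)
import Data.List.Relation.Unary.Unique.Propositional.Properties as Unique
open import Data.Nat using (ℕ; zero; suc; _+_; _*_; _≤_; _<_; _≤?_; _≡ᵇ_; z≤n; s≤s; NonZero; pred)
open import Data.Nat.DivMod
  using (_%_; _/_; m%n<n; m<n⇒m%n≡m; n%n≡0; %-congˡ; %-distribˡ-+; m%n%n≡m%n; [m+n]%n≡m%n; m≡m%n+[m/n]*n)
open import Data.Nat.ListAction using (sum)
open import Data.Nat.ListAction.Properties using (sum-↭)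
open import Data.Nat.Properties
open import Algebra.Properties.Semiring.Sum +-*-semiring
  using (sum-syntax; ∑-comm; ∑-distrib-+; *-distribˡ-sum; sum-cong-≗)
  renaming (sum to ∑)
open import Data.Nat.Tactic.RingSolver using (solve-∀)
open import Data.Product using (_×_; _,_; ∃-syntax; proj₁; proj₂; uncurry)
open import Data.Product.Function.NonDependent.Propositional using (_×-cong_)
open import Data.Sum using (_⊎_; inj₁; inj₂)
open import Data.Sum.Function.Propositional using (_⊎-cong_)
open import Function using (_∘_; id; const; _⇔_; mk⇔; Equivalence)
import Function.Properties.Equivalence as ⇔
open import Function.Related.Propositional using (module EquationalReasoning)
open import Relation.Binary.Definitions using (tri<; tri≈; tri>)
open import Relation.Binary.PropositionalEquality
open import Relation.Nullary using (yes; no)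
open import Relation.Nullary.Decidable using (⌊_⌋; toWitness; fromWitness)

private variable
  A : Set

indicator : Bool → ℕ
indicator b = if b then 1 else 0

indicator-positive : ∀ b → 0 < indicator b → b ≡ true
indicator-positive true _ = refl

signum : ℕ → ℕ
signum zero    = 0
signum (suc _) = 1

signum≤1 : ∀ n → signum n ≤ 1
signum≤1 zero    = z≤n
signum≤1 (suc _) = s≤s z≤n

1≤signum : ∀ {n} → 1 ≤ n → 1 ≤ signum n
1≤signum (s≤s _) = s≤s z≤n

sum-map-filter : (p : A → Bool) (g : A → ℕ) (xs : List A) →
  sum (map g (filter (λ x → p x Bool.≟ true) xs)) ≡ sum (map (λ x → if p x then g x else 0) xs)
sum-map-filter p g [] = refl
sum-map-filter p g (x ∷ xs) with p x
... | true  = cong (g x +_) (sum-map-filter p g xs)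
... | false = sum-map-filter p g xs

length-filter-positive : (f : A → ℕ) (xs : List A) →
  length (filter (λ x → 1 ≤? f x) xs) ≡ sum (map (signum ∘ f) xs)
length-filter-positive f [] = refl
length-filter-positive f (x ∷ xs) with f x
... | zero  = length-filter-positive f xs
... | suc _ = cong suc (length-filter-positive f xs)

sum-map-const : (c : ℕ) (xs : List A) → sum (map (λ _ → c) xs) ≡ length xs * c
sum-map-const c []       = refl
sum-map-const c (x ∷ xs) = cong (c +_) (sum-map-const c xs)

sum-map-scale : (c : ℕ) (g : A → ℕ) (xs : List A) → sum (map (λ x → c * g x) xs) ≡ c * sum (map g xs)
sum-map-scale c g []       = sym (*-zeroʳ c)
sum-map-scale c g (x ∷ xs) = trans (cong (c * g x +_) (sum-map-scale c g xs)) (sym (*-distribˡ-+ c (g x) _))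

sum-map-mono : {g h : A → ℕ} → (∀ x → g x ≤ h x) → (xs : List A) → sum (map g xs) ≤ sum (map h xs)
sum-map-mono g≤h []       = z≤n
sum-map-mono g≤h (x ∷ xs) = +-mono-≤ (g≤h x) (sum-map-mono g≤h xs)

∈⇒≤sum-map : (g : A → ℕ) {x : A} {xs : List A} → x ∈ xs → g x ≤ sum (map g xs)
∈⇒≤sum-map g (here refl) = m≤m+n _ _
∈⇒≤sum-map g (there x∈)  = ≤-trans (∈⇒≤sum-map g x∈) (m≤n+m _ _)

sum-map-positive : (g : A → ℕ) (xs : List A) → 0 < sum (map g xs) → ∃[ x ] x ∈ xs × 0 < g x
sum-map-positive g [] ()
sum-map-positive g (x ∷ xs) pos with g x in gx
... | suc _ = x , here refl , subst (0 <_) (sym gx) (s≤s z≤n)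
... | zero with sum-map-positive g xs pos
...   | y , y∈ , gy>0 = y , there y∈ , gy>0

sum-map-tight : {g h : A → ℕ} → (∀ x → g x ≤ h x) → (xs : List A) →
  sum (map h xs) ≤ sum (map g xs) → All (λ x → g x ≡ h x) xs
sum-map-tight g≤h [] _ = []
sum-map-tight {g = g} {h} g≤h (x ∷ xs) le =
  ≤-antisym (g≤h x) (+-cancelʳ-≤ _ _ _ (≤-trans le (+-monoʳ-≤ (g x) (sum-map-mono g≤h xs))))
  ∷ sum-map-tight g≤h xs (+-cancelˡ-≤ (h x) _ _ (≤-trans le (+-monoˡ-≤ _ (g≤h x))))

sum-tabulate : ∀ {n} (g : Fin n → ℕ) → sum (tabulate g) ≡ ∑[ i < n ] g i
sum-tabulate {zero}  g = refl
sum-tabulate {suc n} g = cong (g zero +_) (sum-tabulate (g ∘ suc))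

sum-map-allFin : ∀ {n} (g : Fin n → ℕ) → sum (map g (allFin n)) ≡ ∑[ i < n ] g i
sum-map-allFin g = trans (cong sum (map-tabulate id g)) (sum-tabulate g)

∑-const : (n c : ℕ) → ∑[ i < n ] c ≡ n * c
∑-const zero    c = refl
∑-const (suc n) c = cong (c +_) (∑-const n c)

∑-mono-≤ : ∀ {n} {g h : Fin n → ℕ} → (∀ i → g i ≤ h i) → ∑[ i < n ] g i ≤ ∑[ i < n ] h i
∑-mono-≤ {zero}  g≤h = z≤n
∑-mono-≤ {suc n} g≤h = +-mono-≤ (g≤h zero) (∑-mono-≤ (g≤h ∘ suc))

Vertex : Graph → Set
Vertex G = Fin (size G)

Symmetric : Graph → Set
Symmetric G = ∀ u v → adj G u v ≡ adj G v u

degree : (G : Graph) → Vertex G → ℕ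
degree G v = length (nbrs G v)

Regular : ℕ → Graph → Set
Regular r G = ∀ v → degree G v ≡ r

nbrSum : (G : Graph) → (Vertex G → ℕ) → Vertex G → ℕ
nbrSum G g v = sum (map g (nbrs G v))

module _ (G : Graph) where

  ∈-nbrs⁺ : {v u : Vertex G} → adj G v u ≡ true → u ∈ nbrs G v
  ∈-nbrs⁺ {v} {u} = ∈-filter⁺ (λ w → adj G v w Bool.≟ true) (∈-allFin u)

  ∈-nbrs⁻ : {v u : Vertex G} → u ∈ nbrs G v → adj G v u ≡ true
  ∈-nbrs⁻ {v} u∈ = proj₂ (∈-filter⁻ (λ w → adj G v w Bool.≟ true) {xs = allFin (size G)} u∈)

  nbrs-↭ : {v : Vertex G} {ns : List (Vertex G)} → Unique ns →
    (∀ {u} → u ∈ ns ⇔ adj G v u ≡ true) → nbrs G v ↭ ns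
  nbrs-↭ {v} ns-unique ∈ns⇔adj = ∼bag⇒↭ (unique∧set⇒bag nbrs-unique ns-unique
    (mk⇔ (Equivalence.from ∈ns⇔adj ∘ ∈-nbrs⁻) (∈-nbrs⁺ ∘ Equivalence.to ∈ns⇔adj)))
    where
    nbrs-unique : Unique (nbrs G v)
    nbrs-unique = Unique.filter⁺ (λ w → adj G v w Bool.≟ true) (allFin⁺ (size G))

  nbrSum-as-∑ : (g : Vertex G → ℕ) (v : Vertex G) →
    nbrSum G g v ≡ ∑[ u < size G ] (if adj G v u then g u else 0)
  nbrSum-as-∑ g v = trans (sum-map-filter (adj G v) g (allFin (size G)))
                          (sum-map-allFin (λ u → if adj G v u then g u else 0))

  nbrSum-const : (c : ℕ) (v : Vertex G) → nbrSum G (λ _ → c) v ≡ degree G v * c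
  nbrSum-const c v = sum-map-const c (nbrs G v)

  activeNbrs-as-nbrSum : (f : Vertex G → ℕ) (v : Vertex G) → activeNbrs G f v ≡ nbrSum G (signum ∘ f) v
  activeNbrs-as-nbrSum f v = length-filter-positive f (nbrs G v)

  activeNbrs≤degree : (f : Vertex G → ℕ) (v : Vertex G) → activeNbrs G f v ≤ degree G v
  activeNbrs≤degree f v = begin
    activeNbrs G f v          ≡⟨ activeNbrs-as-nbrSum f v ⟩
    nbrSum G (signum ∘ f) v   ≤⟨ sum-map-mono (signum≤1 ∘ f) (nbrs G v) ⟩
    nbrSum G (λ _ → 1) v      ≡⟨ nbrSum-const 1 v ⟩
    degree G v * 1            ≡⟨ *-identityʳ _ ⟩
    degree G v                ∎
    where open ≤-Reasoning

-- Deficient vertices of a labeling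

-- For a [k]-RDF these are exactly the vertices with f(N[v]) < k + 1.
deficient : (G : Graph) → ℕ → (Vertex G → ℕ) → Vertex G → ℕ
deficient G k f v = indicator (⌊ f v ≟ k ⌋ ∧ ⌊ nbrSum G f v ≟ 0 ⌋)

module _ (G : Graph) {k : ℕ} (f : Vertex G → ℕ) where

  deficient⇒ : ∀ v → 0 < deficient G k f v → f v ≡ k × nbrSum G f v ≡ 0
  deficient⇒ v _ with f v ≟ k | nbrSum G f v ≟ 0
  ... | yes fv≡k | yes S≡0 = fv≡k , S≡0

  deficient-intro : ∀ v → f v ≡ k → nbrSum G f v ≡ 0 → deficient G k f v ≡ 1
  deficient-intro v fv≡k S≡0 with f v ≟ k | nbrSum G f v ≟ 0
  ... | yes _   | yes _  = refl
  ... | no fv≢k | _      = ⊥-elim (fv≢k fv≡k)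
  ... | yes _   | no S≢0 = ⊥-elim (S≢0 S≡0)

  deficient≤signum : 1 ≤ k → ∀ v → deficient G k f v ≤ signum (f v)
  deficient≤signum 1≤k v with f v ≟ k | nbrSum G f v ≟ 0
  ... | yes fv≡k | yes _ = 1≤signum (subst (1 ≤_) (sym fv≡k) 1≤k)
  ... | yes _    | no _  = z≤n
  ... | no _     | _     = z≤n

  deficient-tight : ∀ v → deficient G k f v ≡ signum (f v) → f v ≡ k * deficient G k f v
  deficient-tight v = tight (f v) (proj₁ ∘ deficient⇒ v)
    where
    tight : ∀ a {d} → (0 < d → a ≡ k) → d ≡ signum a → a ≡ k * d
    tight zero    _        refl = sym (*-zeroʳ k)
    tight (suc a) d>0⇒a≡k refl = trans (d>0⇒a≡k (s≤s z≤n)) (sym (*-identityʳ k))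

  deficientNbrs≤activeNbrs : 1 ≤ k → ∀ v → nbrSum G (deficient G k f) v ≤ activeNbrs G f v
  deficientNbrs≤activeNbrs 1≤k v = subst (nbrSum G (deficient G k f) v ≤_) (sym (activeNbrs-as-nbrSum G f v))
    (sum-map-mono (deficient≤signum 1≤k) (nbrs G v))

  deficientNbr⇒zero : Symmetric G → ∀ v → 0 < nbrSum G (deficient G k f) v → f v ≡ 0
  deficientNbr⇒zero symmetric v δ>0 with sum-map-positive (deficient G k f) (nbrs G v) δ>0
  ... | u , u∈nbrs-v , du>0 =
    n≤0⇒n≡0 (subst (f v ≤_) (proj₂ (deficient⇒ u du>0)) (∈⇒≤sum-map f v∈nbrs-u))
    where
    v∈nbrs-u : v ∈ nbrs G u
    v∈nbrs-u = ∈-nbrs⁺ G (trans (symmetric u v) (∈-nbrs⁻ G u∈nbrs-v))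

  activeNbrs≤deficientNbrs⇒ : 1 ≤ k → ∀ v → activeNbrs G f v ≤ nbrSum G (deficient G k f) v →
    nbrSum G f v ≡ k * nbrSum G (deficient G k f) v
  activeNbrs≤deficientNbrs⇒ 1≤k v p≤δ =
    trans (cong sum (map-cong-local (All.map (λ {u} → deficient-tight u) deficient≡signum)))
          (sum-map-scale k (deficient G k f) (nbrs G v))
    where
    deficient≡signum : All (λ u → deficient G k f u ≡ signum (f u)) (nbrs G v)
    deficient≡signum = sum-map-tight (deficient≤signum 1≤k) (nbrs G v)
      (subst (_≤ nbrSum G (deficient G k f) v) (activeNbrs-as-nbrSum G f v) p≤δ)

-- Here a = f(v), S = f(N(v)), p = |AN(v)|, δ = number of deficient neighbours of v and d = [v deficient].
closedSum-bound : ∀ {k a S p d} → 1 ≤ k →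
  (a < k → k + p ≤ a + S) → (p ≡ 0 → S ≡ 0) → (a ≡ k → S ≡ 0 → d ≡ 1) →
  suc k ≤ a + S + d
closedSum-bound {k} {a} {S} {p} {d} 1≤k condition p≡0⇒S≡0 a≡k⇒S≡0⇒d≡1 with <-cmp a k
... | tri< a<k _ _ = ≤-trans (below-k p (condition a<k) p≡0⇒S≡0) (m≤m+n (a + S) d)
  where
  open ≤-Reasoning
  below-k : ∀ p → k + p ≤ a + S → (p ≡ 0 → S ≡ 0) → suc k ≤ a + S
  below-k zero k+0≤a+S S≡0 = ⊥-elim (<⇒≱ a<k (begin
    k      ≡⟨ +-identityʳ k ⟨
    k + 0  ≤⟨ k+0≤a+S ⟩
    a + S  ≡⟨ cong (a +_) (S≡0 refl) ⟩
    a + 0  ≡⟨ +-identityʳ a ⟩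
    a      ∎))
  below-k (suc q) k+p≤a+S _ = ≤-trans (m<m+n k (s≤s z≤n)) k+p≤a+S
... | tri≈ _ a≡k _ = at-k S (a≡k⇒S≡0⇒d≡1 a≡k)
  where
  at-k : ∀ S → (S ≡ 0 → d ≡ 1) → suc k ≤ a + S + d
  at-k zero    S≡0⇒d≡1 = ≤-reflexive (sym (trans (cong₂ _+_ (trans (+-identityʳ a) a≡k) (S≡0⇒d≡1 refl)) (+-comm k 1)))
  at-k (suc s) _       = ≤-trans (subst (λ x → suc k ≤ x + suc s) (sym a≡k) (m<m+n k (s≤s z≤n))) (m≤m+n _ d)
... | tri> _ _ k<a = ≤-trans k<a (≤-trans (m≤m+n a S) (m≤m+n (a + S) d))

-- Summed over all v, both δ and r · d add up to r times the number of deficient vertices.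
discharging-bound : ∀ {k r a S p δ d} → 1 ≤ k →
  (a < k → k + p ≤ a + S) → p ≤ r → δ ≤ p →
  (0 < δ → a ≡ 0) → (p ≤ δ → S ≡ k * δ) → (a ≡ k → S ≡ 0 → d ≡ 1) →
  r * suc k + δ ≤ r * (a + S) + r * d
discharging-bound {k} {r} {a} {S} {p} {δ} {d} 1≤k condition p≤r δ≤p δ>0⇒a≡0 p≤δ⇒S≡kδ a≡k⇒S≡0⇒d≡1 =
  by-deficientNbrs δ δ≤p δ>0⇒a≡0 p≤δ⇒S≡kδ
  where
  open ≤-Reasoning
  by-deficientNbrs : ∀ δ → δ ≤ p → (0 < δ → a ≡ 0) → (p ≤ δ → S ≡ k * δ) →
    r * suc k + δ ≤ r * (a + S) + r * d
  by-deficientNbrs zero _ _ p≤0⇒S≡0 = begin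
    r * suc k + 0        ≡⟨ +-identityʳ _ ⟩
    r * suc k            ≤⟨ *-monoʳ-≤ r (closedSum-bound 1≤k condition p≡0⇒S≡0 a≡k⇒S≡0⇒d≡1) ⟩
    r * (a + S + d)      ≡⟨ *-distribˡ-+ r (a + S) d ⟩
    r * (a + S) + r * d  ∎
    where
    p≡0⇒S≡0 : p ≡ 0 → S ≡ 0
    p≡0⇒S≡0 refl = trans (p≤0⇒S≡0 z≤n) (*-zeroʳ k)
  by-deficientNbrs (suc e) δ≤p δ>0⇒a≡0 p≤δ⇒S≡kδ =
    by-activeNbrs p (condition (subst (_< k) (sym a≡0) 1≤k)) p≤r δ≤p p≤δ⇒S≡kδ
    where
    a≡0 : a ≡ 0
    a≡0 = δ>0⇒a≡0 (s≤s z≤n)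
    by-activeNbrs : ∀ p → k + p ≤ a + S → p ≤ r → suc e ≤ p → (p ≤ suc e → S ≡ k * suc e) →
      r * suc k + suc e ≤ r * (a + S) + r * d
    by-activeNbrs zero _ _ () _
    by-activeNbrs (suc zero) k+1≤a+S _ (s≤s e≤0) 1≤δ⇒S≡kδ = ⊥-elim (<-irrefl refl (begin-strict
      k          <⟨ m<m+n k (s≤s z≤n) ⟩
      k + 1      ≤⟨ k+1≤a+S ⟩
      a + S      ≡⟨ cong₂ _+_ a≡0 (1≤δ⇒S≡kδ (s≤s z≤n)) ⟩
      k * suc e  ≡⟨ cong (λ x → k * suc x) (n≤0⇒n≡0 e≤0) ⟩
      k * 1      ≡⟨ *-identityʳ k ⟩
      k          ∎))
    by-activeNbrs (suc (suc q)) k+p≤a+S p≤r δ≤p _ = begin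
      r * suc k + suc e        ≤⟨ +-monoʳ-≤ (r * suc k) (≤-trans δ≤p p≤r*[p-1]) ⟩
      r * suc k + r * suc q    ≡⟨ *-distribˡ-+ r (suc k) (suc q) ⟨
      r * (suc k + suc q)      ≡⟨ cong (r *_) (+-suc k (suc q)) ⟨
      r * (k + suc (suc q))    ≤⟨ *-monoʳ-≤ r k+p≤a+S ⟩
      r * (a + S)              ≤⟨ m≤m+n _ _ ⟩
      r * (a + S) + r * d      ∎
      where
      p≤r*[p-1] : suc (suc q) ≤ r * suc q
      p≤r*[p-1] = begin
        suc (suc q)    ≤⟨ s≤s (m≤n+m (suc q) q) ⟩
        suc q + suc q  ≡⟨ cong (suc q +_) (+-identityʳ (suc q)) ⟨
        2 * suc q      ≤⟨ *-monoˡ-≤ (suc q) (≤-trans (s≤s (s≤s z≤n)) p≤r) ⟩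
        r * suc q      ∎

-- Perfect codes

IsPerfectCode : (G : Graph) → (Vertex G → Bool) → Set
IsPerfectCode G D = ∀ v → closedNbrSum G (indicator ∘ D) v ≡ 1

codeLabeling : ∀ {n} → ℕ → (Fin n → Bool) → Fin n → ℕ
codeLabeling k D v = if D v then suc k else 0

sum-map-codeLabeling : ∀ {n} k (D : Fin n → Bool) xs →
  sum (map (codeLabeling k D) xs) ≡ suc k * sum (map (indicator ∘ D) xs)
sum-map-codeLabeling k D xs = trans (cong sum (map-cong (λ u → scaled (D u)) xs))
                                    (sum-map-scale (suc k) (indicator ∘ D) xs)
  where
  scaled : ∀ b → (if b then suc k else 0) ≡ suc k * indicator b
  scaled true  = sym (*-identityʳ (suc k))
  scaled false = sym (*-zeroʳ (suc k))

module _ (G : Graph) {D : Vertex G → Bool} (perfect : IsPerfectCode G D) where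

  nbrSum-perfectCode : ∀ v → D v ≡ false → nbrSum G (indicator ∘ D) v ≡ 1
  nbrSum-perfectCode v Dv = subst (λ b → indicator b + nbrSum G (indicator ∘ D) v ≡ 1) Dv (perfect v)

  perfectCode⇒dominating : IsDominatingSet G D
  perfectCode⇒dominating v with D v in Dv
  ... | true  = inj₁ refl
  ... | false with sum-map-positive (indicator ∘ D) (nbrs G v) (≤-reflexive (sym (nbrSum-perfectCode v Dv)))
  ...   | u , u∈ , Du>0 = inj₂ (u , ∈-nbrs⁻ G u∈ , indicator-positive (D u) Du>0)

  perfectCode⇒KRDF : (k : ℕ) → IsKRDF k G (codeLabeling k D)
  perfectCode⇒KRDF k = bounded , condition
    where
    h : Vertex G → ℕ
    h = codeLabeling k D

    bounded : ∀ v → h v ≤ suc k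
    bounded v with D v
    ... | true  = ≤-refl
    ... | false = z≤n

    activeNbrs≡ : ∀ v → activeNbrs G h v ≡ nbrSum G (indicator ∘ D) v
    activeNbrs≡ v = trans (activeNbrs-as-nbrSum G h v) (cong sum (map-cong (λ u → signum-h (D u)) (nbrs G v)))
      where
      signum-h : ∀ b → signum (if b then suc k else 0) ≡ indicator b
      signum-h true  = refl
      signum-h false = refl

    condition : ∀ v → h v < k → k + activeNbrs G h v ≤ closedNbrSum G h v
    condition v hv<k with D v in Dv
    ... | true  = ⊥-elim (n≮n k (<-trans (n<1+n k) hv<k))
    ... | false = ≤-reflexive (begin
      k + activeNbrs G h v                ≡⟨ cong (k +_) (trans (activeNbrs≡ v) (nbrSum-perfectCode v Dv)) ⟩
      k + 1                               ≡⟨ +-comm k 1 ⟩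
      suc k                               ≡⟨ *-identityʳ (suc k) ⟨
      suc k * 1                           ≡⟨ cong (suc k *_) (nbrSum-perfectCode v Dv) ⟨
      suc k * nbrSum G (indicator ∘ D) v  ≡⟨ sum-map-codeLabeling k D (nbrs G v) ⟨
      nbrSum G h v                        ∎)
      where open ≡-Reasoning

-- Symmetric regular graphs

module _ {G : Graph} (symmetric : Symmetric G) {r : ℕ} (regular : Regular r G) where

  private
    n : ℕ
    n = size G

  handshake : (g : Vertex G → ℕ) → ∑[ v < n ] nbrSum G g v ≡ r * weight G g
  handshake g = begin
    ∑[ v < n ] nbrSum G g v                              ≡⟨ sum-cong-≗ (nbrSum-as-∑ G g) ⟩
    ∑[ v < n ] ∑[ u < n ] (if adj G v u then g u else 0) ≡⟨ ∑-comm (λ v u → if adj G v u then g u else 0) ⟩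
    ∑[ u < n ] ∑[ v < n ] (if adj G v u then g u else 0)
      ≡⟨ sum-cong-≗ (λ u → sum-cong-≗ (λ v → cong (λ b → if b then g u else 0) (symmetric v u))) ⟩
    ∑[ u < n ] ∑[ v < n ] (if adj G u v then g u else 0) ≡⟨ sum-cong-≗ (λ u → nbrSum-as-∑ G (λ _ → g u) u) ⟨
    ∑[ u < n ] nbrSum G (λ _ → g u) u
      ≡⟨ sum-cong-≗ (λ u → trans (nbrSum-const G (g u) u) (cong (_* g u) (regular u))) ⟩
    ∑[ u < n ] (r * g u)                                 ≡⟨ *-distribˡ-sum r g ⟨
    r * (∑[ u < n ] g u)                                 ≡⟨ cong (r *_) (sum-map-allFin g) ⟨
    r * weight G g                                       ∎
    where open ≡-Reasoning

  closed-handshake : (g : Vertex G → ℕ) → ∑[ v < n ] closedNbrSum G g v ≡ suc r * weight G g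
  closed-handshake g = begin
    ∑[ v < n ] (g v + nbrSum G g v)               ≡⟨ ∑-distrib-+ g (nbrSum G g) ⟩
    (∑[ v < n ] g v) + (∑[ v < n ] nbrSum G g v)  ≡⟨ cong₂ _+_ (sym (sum-map-allFin g)) (handshake g) ⟩
    weight G g + r * weight G g                   ∎
    where open ≡-Reasoning

  dominatingSet-lowerBound : {D : Vertex G → Bool} → IsDominatingSet G D → n ≤ suc r * setSize G D
  dominatingSet-lowerBound {D} dominating = begin
    n                                           ≡⟨ *-identityʳ n ⟨
    n * 1                                       ≡⟨ ∑-const n 1 ⟨
    ∑[ v < n ] 1                                ≤⟨ ∑-mono-≤ dominated ⟩
    ∑[ v < n ] closedNbrSum G (indicator ∘ D) v ≡⟨ closed-handshake (indicator ∘ D) ⟩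
    suc r * setSize G D                         ∎
    where
    open ≤-Reasoning
    dominated : ∀ v → 1 ≤ closedNbrSum G (indicator ∘ D) v
    dominated v with dominating v
    ... | inj₁ Dv rewrite Dv = s≤s z≤n
    ... | inj₂ (u , adj-vu , Du) = ≤-trans (≤-reflexive (cong indicator (sym Du)))
      (≤-trans (∈⇒≤sum-map (indicator ∘ D) (∈-nbrs⁺ G adj-vu)) (m≤n+m _ _))

  perfectCode-size : {D : Vertex G → Bool} → IsPerfectCode G D → suc r * setSize G D ≡ n
  perfectCode-size {D} perfect = begin
    suc r * setSize G D                         ≡⟨ closed-handshake (indicator ∘ D) ⟨
    ∑[ v < n ] closedNbrSum G (indicator ∘ D) v ≡⟨ sum-cong-≗ perfect ⟩
    ∑[ v < n ] 1                                ≡⟨ ∑-const n 1 ⟩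
    n * 1                                       ≡⟨ *-identityʳ n ⟩
    n                                           ∎
    where open ≡-Reasoning

  romanLowerBound : ∀ {k} {f : Vertex G → ℕ} .{{_ : NonZero r}} → 1 ≤ k → IsKRDF k G f →
    n * suc k ≤ suc r * weight G f
  romanLowerBound {k} {f} 1≤k (_ , condition) = *-cancelˡ-≤ r (+-cancelʳ-≤ (r * weight G d) _ _ (begin
    r * (n * suc k) + r * weight G d                   ≡⟨ cong₂ _+_ reorder (handshake d) ⟨
    n * (r * suc k) + ∑[ v < n ] nbrSum G d v          ≡⟨ cong (_+ ∑[ v < n ] nbrSum G d v) (∑-const n (r * suc k)) ⟨
    ∑[ v < n ] (r * suc k) + ∑[ v < n ] nbrSum G d v   ≡⟨ ∑-distrib-+ (λ _ → r * suc k) (nbrSum G d) ⟨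
    ∑[ v < n ] (r * suc k + nbrSum G d v)             ≤⟨ ∑-mono-≤ local ⟩
    ∑[ v < n ] (r * closedNbrSum G f v + r * d v)     ≡⟨ ∑-distrib-+ (λ v → r * closedNbrSum G f v) (λ v → r * d v) ⟩
    ∑[ v < n ] (r * closedNbrSum G f v) + ∑[ v < n ] (r * d v)
      ≡⟨ cong₂ _+_ (*-distribˡ-sum r (closedNbrSum G f)) (*-distribˡ-sum r d) ⟨
    r * ∑[ v < n ] closedNbrSum G f v + r * ∑[ v < n ] d v
      ≡⟨ cong₂ _+_ (cong (r *_) (closed-handshake f)) (cong (r *_) (sym (sum-map-allFin d))) ⟩
    r * (suc r * weight G f) + r * weight G d          ∎))
    where
    open ≤-Reasoning
    d : Vertex G → ℕ
    d = deficient G k f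

    reorder : n * (r * suc k) ≡ r * (n * suc k)
    reorder = trans (sym (*-assoc n r (suc k))) (trans (cong (_* suc k) (*-comm n r)) (*-assoc r n (suc k)))

    local : ∀ v → r * suc k + nbrSum G d v ≤ r * closedNbrSum G f v + r * d v
    local v = discharging-bound 1≤k (condition v)
      (≤-trans (activeNbrs≤degree G f v) (≤-reflexive (regular v)))
      (deficientNbrs≤activeNbrs G f 1≤k v) (deficientNbr⇒zero G f symmetric v)
      (activeNbrs≤deficientNbrs⇒ G f 1≤k v) (deficient-intro G f v)

-- The prism C_m □ P_2

∨-shuffle : ∀ p q r s → p ∨ q ∨ r ∨ s ≡ (p ∨ s) ∨ (q ∨ r)
∨-shuffle true  q r s = refl
∨-shuffle false q r s = trans (sym (∨-assoc q r s)) (∨-comm (q ∨ r) s)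

T-≡ᵇ : ∀ {x y} → T (x ≡ᵇ y) ⇔ x ≡ y
T-≡ᵇ {x} {y} = mk⇔ (≡ᵇ⇒≡ x y) (≡⇒≡ᵇ x y)

T-⌊≟⌋ : ∀ {n} {i j : Fin n} → T ⌊ i Fin.≟ j ⌋ ⇔ i ≡ j
T-⌊≟⌋ = mk⇔ toWitness fromWitness

⌊≟⌋-sym : ∀ {n} (i j : Fin n) → ⌊ i Fin.≟ j ⌋ ≡ ⌊ j Fin.≟ i ⌋
⌊≟⌋-sym i j with i Fin.≟ j | j Fin.≟ i
... | yes _   | yes _   = refl
... | no _    | no _    = refl
... | yes i≡j | no j≢i  = ⊥-elim (j≢i (sym i≡j))
... | no i≢j  | yes j≡i = ⊥-elim (i≢j (sym j≡i))

[m+n%d]%d≡[m+n]%d : ∀ m n d .{{_ : NonZero d}} → (m + n % d) % d ≡ (m + n) % d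
[m+n%d]%d≡[m+n]%d m n d = begin
  (m + n % d) % d          ≡⟨ %-distribˡ-+ m (n % d) d ⟩
  (m % d + n % d % d) % d  ≡⟨ cong (λ z → (m % d + z) % d) (m%n%n≡m%n n d) ⟩
  (m % d + n % d) % d      ≡⟨ %-distribˡ-+ m n d ⟨
  (m + n) % d              ∎
  where open ≡-Reasoning

module _ (m : ℕ) where

  isNext : Fin m → Fin m → Bool
  isNext a c = (toℕ c ≡ᵇ suc (toℕ a)) ∨ ((toℕ c ≡ᵇ 0) ∧ (suc (toℕ a) ≡ᵇ m))

  cycle-adj : ∀ a c → adj (cycle m) a c ≡ isNext a c ∨ isNext c a
  cycle-adj a c = ∨-shuffle (toℕ c ≡ᵇ suc (toℕ a)) (toℕ a ≡ᵇ suc (toℕ c))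
    ((toℕ a ≡ᵇ 0) ∧ (suc (toℕ c) ≡ᵇ m)) ((toℕ c ≡ᵇ 0) ∧ (suc (toℕ a) ≡ᵇ m))

  cycle-symmetric : Symmetric (cycle m)
  cycle-symmetric a c = trans (cycle-adj a c) (trans (∨-comm (isNext a c) (isNext c a)) (sym (cycle-adj c a)))

  T-isNext : ∀ a c → T (isNext a c) ⇔ (toℕ c ≡ suc (toℕ a) ⊎ toℕ c ≡ 0 × suc (toℕ a) ≡ m)
  T-isNext a c = ⇔.trans T-∨ (T-≡ᵇ ⊎-cong ⇔.trans T-∧ (T-≡ᵇ ×-cong T-≡ᵇ))

module _ (m : ℕ) .{{_ : NonZero m}} where

  next prev : Fin m → Fin m
  next a = fromℕ< (m%n<n (suc (toℕ a)) m)
  prev a = fromℕ< (m%n<n (pred m + toℕ a) m)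

  toℕ-next : ∀ a → toℕ (next a) ≡ suc (toℕ a) % m
  toℕ-next a = toℕ-fromℕ< (m%n<n (suc (toℕ a)) m)

  toℕ-prev : ∀ a → toℕ (prev a) ≡ (pred m + toℕ a) % m
  toℕ-prev a = toℕ-fromℕ< (m%n<n (pred m + toℕ a) m)

  ≡next⇔ : ∀ a c → c ≡ next a ⇔ (toℕ c ≡ suc (toℕ a) ⊎ toℕ c ≡ 0 × suc (toℕ a) ≡ m)
  ≡next⇔ a c = mk⇔ (λ c≡ → to (trans (cong toℕ c≡) (toℕ-next a)))
                   (λ spec → toℕ-injective (trans (from spec) (sym (toℕ-next a))))
    where
    to : toℕ c ≡ suc (toℕ a) % m → toℕ c ≡ suc (toℕ a) ⊎ toℕ c ≡ 0 × suc (toℕ a) ≡ m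
    to c≡ with m≤n⇒m<n∨m≡n (toℕ<n a)
    ... | inj₁ 1+a<m = inj₁ (trans c≡ (m<n⇒m%n≡m 1+a<m))
    ... | inj₂ 1+a≡m = inj₂ (trans c≡ (trans (%-congˡ 1+a≡m) (n%n≡0 m)) , 1+a≡m)
    from : toℕ c ≡ suc (toℕ a) ⊎ toℕ c ≡ 0 × suc (toℕ a) ≡ m → toℕ c ≡ suc (toℕ a) % m
    from (inj₁ c≡1+a)         = trans c≡1+a (sym (m<n⇒m%n≡m (subst (_< m) c≡1+a (toℕ<n c))))
    from (inj₂ (c≡0 , 1+a≡m)) = trans c≡0 (sym (trans (%-congˡ 1+a≡m) (n%n≡0 m)))

  [m+n]%m≡n : ∀ {n} → n < m → (m + n) % m ≡ n
  [m+n]%m≡n {n} n<m = trans (%-congˡ (+-comm m n)) (trans ([m+n]%n≡m%n n m) (m<n⇒m%n≡m n<m))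

  next-prev : ∀ a → next (prev a) ≡ a
  next-prev a = toℕ-injective (begin
    toℕ (next (prev a))             ≡⟨ toℕ-next (prev a) ⟩
    suc (toℕ (prev a)) % m          ≡⟨ cong (λ z → suc z % m) (toℕ-prev a) ⟩
    (1 + (pred m + toℕ a) % m) % m  ≡⟨ [m+n%d]%d≡[m+n]%d 1 (pred m + toℕ a) m ⟩
    (suc (pred m) + toℕ a) % m      ≡⟨ cong (λ z → (z + toℕ a) % m) (suc-pred m) ⟩
    (m + toℕ a) % m                 ≡⟨ [m+n]%m≡n (toℕ<n a) ⟩
    toℕ a                           ∎)
    where open ≡-Reasoning

  prev-next : ∀ a → prev (next a) ≡ a
  prev-next a = toℕ-injective (begin
    toℕ (prev (next a))             ≡⟨ toℕ-prev (next a) ⟩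
    (pred m + toℕ (next a)) % m     ≡⟨ cong (λ z → (pred m + z) % m) (toℕ-next a) ⟩
    (pred m + suc (toℕ a) % m) % m  ≡⟨ [m+n%d]%d≡[m+n]%d (pred m) (suc (toℕ a)) m ⟩
    (pred m + suc (toℕ a)) % m      ≡⟨ cong (_% m) (trans (+-suc (pred m) (toℕ a)) (cong (_+ toℕ a) (suc-pred m))) ⟩
    (m + toℕ a) % m                 ≡⟨ [m+n]%m≡n (toℕ<n a) ⟩
    toℕ a                           ∎)
    where open ≡-Reasoning

  ≡prev⇔ : ∀ a c → c ≡ prev a ⇔ a ≡ next c
  ≡prev⇔ a c = mk⇔ (λ c≡ → trans (sym (next-prev a)) (cong next (sym c≡)))
                   (λ a≡ → trans (sym (prev-next c)) (cong prev (sym a≡)))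

  cycle-adj⇔ : ∀ a c → T (adj (cycle m) a c) ⇔ (c ≡ next a ⊎ c ≡ prev a)
  cycle-adj⇔ a c = begin
    T (adj (cycle m) a c)                  ≡⟨ cong T (cycle-adj m a c) ⟩
    T (isNext m a c ∨ isNext m c a)        ∼⟨ T-∨ ⟩
    (T (isNext m a c) ⊎ T (isNext m c a))
      ∼⟨ ⇔.trans (T-isNext m a c) (⇔.sym (≡next⇔ a c))
         ⊎-cong ⇔.trans (T-isNext m c a) (⇔.sym (⇔.trans (≡prev⇔ a c) (≡next⇔ c a))) ⟩
    (c ≡ next a ⊎ c ≡ prev a)              ∎
    where open EquationalReasoning

  next≢prev : 3 ≤ m → ∀ a → next a ≢ prev a
  next≢prev 3≤m a next≡prev = twoCycle (Equivalence.to (≡next⇔ a (next a)) refl)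
    (Equivalence.to (≡next⇔ (next a) a) (Equivalence.to (≡prev⇔ a (next a)) next≡prev))
    where
    below3≢m : ∀ {j} → j < 3 → j ≢ m
    below3≢m j<3 j≡m = <⇒≱ j<3 (subst (3 ≤_) (sym j≡m) 3≤m)
    twoCycle : ∀ {x y} → (y ≡ suc x ⊎ y ≡ 0 × suc x ≡ m) → (x ≡ suc y ⊎ x ≡ 0 × suc y ≡ m) → ⊥
    twoCycle {x} (inj₁ refl)         (inj₁ x≡2+x)        = <-irrefl x≡2+x (m<n+m x (s≤s z≤n))
    twoCycle     (inj₁ refl)         (inj₂ (refl , 2≡m)) = below3≢m (s≤s (s≤s (s≤s z≤n))) 2≡m
    twoCycle     (inj₂ (refl , 2≡m)) (inj₁ refl)         = below3≢m (s≤s (s≤s (s≤s z≤n))) 2≡m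
    twoCycle     (inj₂ (refl , _))   (inj₂ (_ , 1≡m))    = below3≢m (s≤s (s≤s z≤n)) 1≡m

path-symmetric : ∀ n → Symmetric (path n)
path-symmetric n b d = ∨-comm (toℕ d ≡ᵇ suc (toℕ b)) (toℕ b ≡ᵇ suc (toℕ d))

path₂-adj⇔ : ∀ b d → T (adj (path 2) b d) ⇔ d ≡ opposite b
path₂-adj⇔ 0F 0F = mk⇔ (λ ()) (λ ())
path₂-adj⇔ 0F 1F = mk⇔ (const refl) (const _)
path₂-adj⇔ 1F 0F = mk⇔ (const refl) (const _)
path₂-adj⇔ 1F 1F = mk⇔ (λ ()) (λ ())

opposite₂≢id : ∀ (b : Fin 2) → opposite b ≢ b
opposite₂≢id 0F ()
opposite₂≢id 1F ()

module _ (G H : Graph) where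

  □-adj : ∀ a b c d → adj (G □ H) (combine a b) (combine c d) ≡ (⌊ a Fin.≟ c ⌋ ∧ adj H b d) ∨ (adj G a c ∧ ⌊ b Fin.≟ d ⌋)
  □-adj a b c d = cong₂ adjPairs (remQuot-combine a b) (remQuot-combine c d)
    where
    adjPairs : Vertex G × Vertex H → Vertex G × Vertex H → Bool
    adjPairs (a , b) (c , d) = (⌊ a Fin.≟ c ⌋ ∧ adj H b d) ∨ (adj G a c ∧ ⌊ b Fin.≟ d ⌋)

  □-symmetric : Symmetric G → Symmetric H → Symmetric (G □ H)
  □-symmetric G-symmetric H-symmetric x y = subst₂ (λ x y → adj (G □ H) x y ≡ adj (G □ H) y x)
    (combine-remQuot {size G} (size H) x) (combine-remQuot {size G} (size H) y)
    (on-pairs (remQuot {size G} (size H) x) (remQuot {size G} (size H) y))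
    where
    on-pairs : ∀ p q → adj (G □ H) (uncurry combine p) (uncurry combine q) ≡ adj (G □ H) (uncurry combine q) (uncurry combine p)
    on-pairs (a , b) (c , d) = begin
      adj (G □ H) (combine a b) (combine c d)                   ≡⟨ □-adj a b c d ⟩
      (⌊ a Fin.≟ c ⌋ ∧ adj H b d) ∨ (adj G a c ∧ ⌊ b Fin.≟ d ⌋)
        ≡⟨ cong₂ _∨_ (cong₂ _∧_ (⌊≟⌋-sym a c) (H-symmetric b d)) (cong₂ _∧_ (G-symmetric a c) (⌊≟⌋-sym b d)) ⟩
      (⌊ c Fin.≟ a ⌋ ∧ adj H d b) ∨ (adj G c a ∧ ⌊ d Fin.≟ b ⌋) ≡⟨ □-adj c d a b ⟨
      adj (G □ H) (combine c d) (combine a b)                   ∎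
      where open ≡-Reasoning

prism : ℕ → Graph
prism m = cycle m □ path 2

prism-symmetric : ∀ m → Symmetric (prism m)
prism-symmetric m = □-symmetric (cycle m) (path 2) (cycle-symmetric m) (path-symmetric 2)

module _ (m : ℕ) .{{_ : NonZero m}} (3≤m : 3 ≤ m) where

  prismNbrs : Fin m → Fin 2 → List (Vertex (prism m))
  prismNbrs a b = combine a (opposite b) ∷ combine (next m a) b ∷ combine (prev m a) b ∷ []

  prism-nbrs : ∀ a b → nbrs (prism m) (combine a b) ↭ prismNbrs a b
  prism-nbrs a b = nbrs-↭ (prism m) distinct
    (λ {u} → subst (λ u → u ∈ prismNbrs a b ⇔ adj (prism m) (combine a b) u ≡ true)
                   (combine-remQuot {m} 2 u) (∈⇔adj (remQuot 2 u)))
    where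
    Neighbour : Fin m → Fin 2 → Set
    Neighbour c d = (a ≡ c × d ≡ opposite b) ⊎ ((c ≡ next m a ⊎ c ≡ prev m a) × b ≡ d)

    T-adj⇔ : ∀ c d → T (adj (prism m) (combine a b) (combine c d)) ⇔ Neighbour c d
    T-adj⇔ c d = begin
      T (adj (prism m) (combine a b) (combine c d))
        ≡⟨ cong T (□-adj (cycle m) (path 2) a b c d) ⟩
      T ((⌊ a Fin.≟ c ⌋ ∧ adj (path 2) b d) ∨ (adj (cycle m) a c ∧ ⌊ b Fin.≟ d ⌋))
        ∼⟨ ⇔.trans T-∨ (⇔.trans T-∧ (T-⌊≟⌋ ×-cong path₂-adj⇔ b d) ⊎-cong ⇔.trans T-∧ (cycle-adj⇔ m a c ×-cong T-⌊≟⌋)) ⟩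
      Neighbour c d ∎
      where open EquationalReasoning

    ∈⇔Neighbour : ∀ c d → combine c d ∈ prismNbrs a b ⇔ Neighbour c d
    ∈⇔Neighbour c d = mk⇔ to from
      where
      to : combine c d ∈ prismNbrs a b → Neighbour c d
      to (here eq) with combine-injective c d a (opposite b) eq
      ... | c≡a , d≡b′ = inj₁ (sym c≡a , d≡b′)
      to (there (here eq)) with combine-injective c d (next m a) b eq
      ... | c≡ , d≡b = inj₂ (inj₁ c≡ , sym d≡b)
      to (there (there (here eq))) with combine-injective c d (prev m a) b eq
      ... | c≡ , d≡b = inj₂ (inj₂ c≡ , sym d≡b)
      from : Neighbour c d → combine c d ∈ prismNbrs a b
      from (inj₁ (refl , refl))        = here refl
      from (inj₂ (inj₁ refl , refl)) = there (here refl)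
      from (inj₂ (inj₂ refl , refl)) = there (there (here refl))

    ∈⇔adj : ∀ p → uncurry combine p ∈ prismNbrs a b ⇔ adj (prism m) (combine a b) (uncurry combine p) ≡ true
    ∈⇔adj (c , d) = ⇔.trans (∈⇔Neighbour c d) (⇔.trans (⇔.sym (T-adj⇔ c d)) T-≡)

    distinct : Unique (prismNbrs a b)
    distinct = (vertical≢ (next m a) ∷ vertical≢ (prev m a) ∷ [])
             ∷ ((λ eq → next≢prev m 3≤m a (proj₁ (combine-injective _ b _ b eq))) ∷ [])
             ∷ [] ∷ []
      where
      vertical≢ : ∀ c → combine a (opposite b) ≢ combine c b
      vertical≢ c eq = opposite₂≢id b (proj₂ (combine-injective a (opposite b) c b eq))

  prism-regular : Regular 3 (prism m)
  prism-regular v = subst (λ v → degree (prism m) v ≡ 3) (combine-remQuot {m} 2 v)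
    (↭-length (prism-nbrs (proj₁ (remQuot {m} 2 v)) (proj₂ (remQuot {m} 2 v))))

codeword : ℕ → Fin 2 → Bool
codeword 0 0F = true
codeword 2 1F = true
codeword (suc (suc (suc (suc x)))) b = codeword x b
codeword _ _ = false

codeword-+4* : ∀ q x b → codeword (q * 4 + x) b ≡ codeword x b
codeword-+4* zero    x b = refl
codeword-+4* (suc q) x b = codeword-+4* q x b

codeword-perfect : ∀ x b → indicator (codeword x b) + (indicator (codeword x (opposite b))
  + (indicator (codeword (suc x) b) + (indicator (codeword (3 + x) b) + 0))) ≡ 1
codeword-perfect 0 0F = refl
codeword-perfect 0 1F = refl
codeword-perfect 1 0F = refl
codeword-perfect 1 1F = refl
codeword-perfect 2 0F = refl
codeword-perfect 2 1F = refl
codeword-perfect 3 0F = refl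
codeword-perfect 3 1F = refl
codeword-perfect (suc (suc (suc (suc x)))) b = codeword-perfect x b

3≤4*[1+t] : ∀ t → 3 ≤ 4 * suc t
3≤4*[1+t] t = ≤-trans (s≤s (s≤s (s≤s z≤n))) (*-monoʳ-≤ 4 (s≤s (z≤n {t})))

module _ (t : ℕ) where

  private
    m : ℕ
    m = 4 * suc t

  code : Vertex (prism m) → Bool
  code v = codeword (toℕ (proj₁ (remQuot {m} 2 v))) (proj₂ (remQuot {m} 2 v))

  code-combine : ∀ (a : Fin m) b → code (combine a b) ≡ codeword (toℕ a) b
  code-combine a b = cong (λ p → codeword (toℕ (proj₁ p)) (proj₂ p)) (remQuot-combine {k = 2} a b)

  codeword-%m : ∀ x b → codeword (x % m) b ≡ codeword x b
  codeword-%m x b = begin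
    codeword (x % m) b                      ≡⟨ codeword-+4* (x / m * suc t) (x % m) b ⟨
    codeword (x / m * suc t * 4 + x % m) b
      ≡⟨ cong (λ y → codeword y b) (trans (regroup (x % m) (x / m) t) (sym (m≡m%n+[m/n]*n x m))) ⟩
    codeword x b                            ∎
    where
    open ≡-Reasoning
    regroup : ∀ r q t → q * suc t * 4 + r ≡ r + q * (4 * suc t)
    regroup = solve-∀

  code-next : ∀ (a : Fin m) b → code (combine (next m a) b) ≡ codeword (suc (toℕ a)) b
  code-next a b = begin
    code (combine (next m a) b)  ≡⟨ code-combine (next m a) b ⟩
    codeword (toℕ (next m a)) b  ≡⟨ cong (λ y → codeword y b) (toℕ-next m a) ⟩
    codeword (suc (toℕ a) % m) b ≡⟨ codeword-%m (suc (toℕ a)) b ⟩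
    codeword (suc (toℕ a)) b     ∎
    where open ≡-Reasoning

  code-prev : ∀ (a : Fin m) b → code (combine (prev m a) b) ≡ codeword (3 + toℕ a) b
  code-prev a b = begin
    code (combine (prev m a) b)        ≡⟨ code-combine (prev m a) b ⟩
    codeword (toℕ (prev m a)) b        ≡⟨ cong (λ y → codeword y b) (toℕ-prev m a) ⟩
    codeword ((pred m + toℕ a) % m) b  ≡⟨ codeword-%m (pred m + toℕ a) b ⟩
    codeword (pred m + toℕ a) b        ≡⟨ cong (λ y → codeword y b) (regroup t (toℕ a)) ⟩
    codeword (t * 4 + (3 + toℕ a)) b   ≡⟨ codeword-+4* t (3 + toℕ a) b ⟩
    codeword (3 + toℕ a) b             ∎
    where
    open ≡-Reasoning
    regroup : ∀ t x → t + 3 * suc t + x ≡ t * 4 + (3 + x)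
    regroup = solve-∀

  code-perfect : IsPerfectCode (prism m) code
  code-perfect v = subst (λ v → closedNbrSum (prism m) (indicator ∘ code) v ≡ 1) (combine-remQuot {m} 2 v)
                         (at (proj₁ (remQuot {m} 2 v)) (proj₂ (remQuot {m} 2 v)))
    where
    g : Vertex (prism m) → ℕ
    g = indicator ∘ code
    at : ∀ (a : Fin m) b → closedNbrSum (prism m) g (combine a b) ≡ 1
    at a b = begin
      closedNbrSum (prism m) g (combine a b)
        ≡⟨ cong (g (combine a b) +_) (sum-↭ (map⁺ g (prism-nbrs m (3≤4*[1+t] t) a b))) ⟩
      g (combine a b) + (g (combine a (opposite b)) + (g (combine (next m a) b) + (g (combine (prev m a) b) + 0)))
        ≡⟨ cong₂ _+_ (cong indicator (code-combine a b)) (cong₂ _+_ (cong indicator (code-combine a (opposite b)))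
             (cong₂ _+_ (cong indicator (code-next a b)) (cong (_+ 0) (cong indicator (code-prev a b))))) ⟩
      indicator (codeword (toℕ a) b) + (indicator (codeword (toℕ a) (opposite b))
        + (indicator (codeword (suc (toℕ a)) b) + (indicator (codeword (3 + toℕ a) b) + 0)))
        ≡⟨ codeword-perfect (toℕ a) b ⟩
      1 ∎
      where open ≡-Reasoning

mainTheorem4 : (t k : ℕ) → 1 ≤ t → 1 ≤ k →
    KRomanDominationNumberIs k (cycle (4 * t) □ path 2) ((k + 1) * (2 * t))
      × DominationNumberIs (cycle (4 * t) □ path 2) (2 * t)
mainTheorem4 (suc t) k (s≤s z≤n) 1≤k =
  ((codeLabeling k (code t) , perfectCode⇒KRDF G (code-perfect t) k , labeling-weight) , romanMinimal) ,
  ((code t , perfectCode⇒dominating G (code-perfect t) , code-size) , dominationMinimal)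
  where
  G : Graph
  G = prism (4 * suc t)
  symmetric : Symmetric G
  symmetric = prism-symmetric (4 * suc t)
  cubic : Regular 3 G
  cubic = prism-regular (4 * suc t) (3≤4*[1+t] t)
  order : size G ≡ 4 * (2 * suc t)
  order = trans (*-assoc 4 (suc t) 2) (cong (4 *_) (*-comm (suc t) 2))
  code-size : setSize G (code t) ≡ 2 * suc t
  code-size = *-cancelˡ-≡ _ _ 4 (trans (perfectCode-size symmetric cubic (code-perfect t)) order)
  labeling-weight : weight G (codeLabeling k (code t)) ≡ (k + 1) * (2 * suc t)
  labeling-weight = trans (sum-map-codeLabeling k (code t) (allFin (size G))) (cong₂ _*_ (+-comm 1 k) code-size)
  roman-order : ∀ t k → 4 * suc t * 2 * suc k ≡ 4 * ((k + 1) * (2 * suc t))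
  roman-order = solve-∀
  romanMinimal : ∀ f → IsKRDF k G f → (k + 1) * (2 * suc t) ≤ weight G f
  romanMinimal f isKRDF =
    *-cancelˡ-≤ 4 (subst (_≤ 4 * weight G f) (roman-order t k) (romanLowerBound symmetric cubic 1≤k isKRDF))
  dominationMinimal : ∀ D → IsDominatingSet G D → 2 * suc t ≤ setSize G D
  dominationMinimal D dominating =
    *-cancelˡ-≤ 4 (subst (_≤ 4 * setSize G D) order (dominatingSet-lowerBound symmetric cubic dominating))
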